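{- Let $\mathcal{L}\subseteq\mathbb{Z}^n$ be a lattice, let $\sigma\subseteq\{1,\dots,n\}$ be such that $\ker(\pi_\sigma)\cap\mathcal{L}=\{0\}$, and let $S\subseteq\mathcal{L}^\sigma$. Then $S$ is a generating set of $\mathcal{L}^\sigma$ if and only if $\pi^{ -1}_\sigma(S)$ is a $\sigma$-generating set of $\mathcal{L}$.
   Context: With $\bar\sigma=\{1,\dots,n\}\setminus\sigma$, $\pi_\sigma:\mathbb{Z}^n\to\mathbb{Z}^{|\bar\sigma|}$ projects onto the coordinates in $\bar\sigma$, $\mathcal{L}^\sigma:=\pi_\sigma(\mathcal{L})$, and since $\ker(\pi_\sigma)\cap\mathcal{L}=\{0\}$, $\pi^{ -1}_\sigma:\mathcal{L}^\sigma\to\mathcal{L}$ denotes the inverse of the bijection $\pi_\sigma|_{\mathcal{L}}$. For a lattice $\mathcal{M}\subseteq\mathbb{Z}^m$ and $b\in\mathbb{Z}^m$, $\mathcal{F}_{\mathcal{M},b}:=\{x\in\mathbb{N}^m:x\equiv b\pmod{\mathcal{M}}\}$; $S\subseteq\mathcal{M}$ is a generating set of $\mathcal{M}$ if for every $b$ the undirected graph on $\mathcal{F}_{\mathcal{M},b}$ with an edge $\{x,y\}$ whenever $x-y\in S$ or $y-x\in S$ is connected. For $\tau\subseteq\{1,\dots,n\}$ with complement $\bar\tau$ and $b\in\mathbb{Z}^n$, $\mathcal{F}^\tau_{\mathcal{L},b}:=\{z\in\mathbb{Z}^n:z\equiv b\pmod{\mathcal{L}},\ z_j\ge0\ \forall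 j\in\bar\tau\}$, and $T\subseteq\mathcal{L}$ is a $\tau$-generating set of $\mathcal{L}$ if for every $b\in\mathbb{Z}^n$ the undirected graph on $\mathcal{F}^\tau_{\mathcal{L},b}$ with an edge $\{x,y\}$ whenever $x-y\in T$ or $y-x\in T$ is connected. -}

module Defs where

open import Data.Nat using (ℕ; zero; suc)
open import Data.Integer using (ℤ; +_; _-_; -_; _≤_) renaming (_+_ to _+ℤ_)
open import Data.Fin using (Fin; zero; suc)
open import Data.Fin.Subset using (Subset; _∉_)
open import Data.Bool using (true; false)
open import Data.Vec using (Vec; []; _∷_; lookup; tabulate; zipWith; map; replicate)
open import Data.Product using (Σ; _×_; ∃)
open import Data.Sum using (_⊎_)
open import Relation.Binary.PropositionalEquality using (_≡_)
open import Relation.Binary.Construct.Closure.ReflexiveTransitive using (Star)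

ZSet : ℕ → Set₁
ZSet n = Vec ℤ n → Set

_⊕_ : ∀ {n} → Vec ℤ n → Vec ℤ n → Vec ℤ n
_⊕_ = zipWith _+ℤ_

_⊖_ : ∀ {n} → Vec ℤ n → Vec ℤ n → Vec ℤ n
_⊖_ = zipWith _-_

𝟘 : ∀ {n} → Vec ℤ n
𝟘 = replicate _ (+ 0)

record IsLattice {n : ℕ} (L : ZSet n) : Set where
  field
    zero-mem : L 𝟘
    add-mem  : ∀ x y → L x → L y → L (x ⊕ y)
    neg-mem  : ∀ x → L x → L (map -_ x)

-- Number of coordinates in the complement σ̄ of σ (σ ⊆ {1..n} as a Subset n,
-- true = inside σ).
nOut : ∀ {n} → Subset n → ℕ
nOut [] = 0
nOut (false ∷ σ) = suc (nOut σ)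
nOut (true ∷ σ) = nOut σ

idxOut : ∀ {n} (σ : Subset n) → Fin (nOut σ) → Fin n
idxOut (false ∷ σ) zero = zero
idxOut (false ∷ σ) (suc i) = suc (idxOut σ i)
idxOut (true ∷ σ) i = suc (idxOut σ i)

proj : ∀ {n} (σ : Subset n) → Vec ℤ n → Vec ℤ (nOut σ)
proj σ x = tabulate (λ i → lookup x (idxOut σ i))

projLattice : ∀ {n} (σ : Subset n) → ZSet n → ZSet (nOut σ)
projLattice σ L y = ∃ λ x → L x × proj σ x ≡ y

KerTrivial : ∀ {n} (σ : Subset n) → ZSet n → Set
KerTrivial σ L = ∀ x → L x → proj σ x ≡ 𝟘 → x ≡ 𝟘

-- π_σ^{-1}(S) for S ⊆ 𝓛^σ (inverse of the bijection π_σ|_𝓛)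
preimage : ∀ {n} (σ : Subset n) → ZSet n → ZSet (nOut σ) → ZSet n
preimage σ L S x = L x × S (proj σ x)

Edge : ∀ {m} → ZSet m → ZSet m → Vec ℤ m → Vec ℤ m → Set
Edge F S x y = F x × F y × (S (x ⊖ y) ⊎ S (y ⊖ x))

Connected : ∀ {m} → ZSet m → ZSet m → Set
Connected F S = ∀ x y → F x → F y → Star (Edge F S) x y

Fiber : ∀ {m} → ZSet m → Vec ℤ m → ZSet m
Fiber M b x = (∀ i → + 0 ≤ lookup x i) × M (x ⊖ b)

IsGeneratingSet : ∀ {m} → ZSet m → ZSet m → Set
IsGeneratingSet M S = (∀ x → S x → M x) × (∀ b → Connected (Fiber M b) S)

TauFiber : ∀ {n} → Subset n → ZSet n → Vec ℤ n → ZSet n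
TauFiber τ L b z = (∀ j → j ∉ τ → + 0 ≤ lookup z j) × L (z ⊖ b)

IsTauGeneratingSet : ∀ {n} → Subset n → ZSet n → ZSet n → Set
IsTauGeneratingSet τ L T = (∀ x → T x → L x) × (∀ b → Connected (TauFiber τ L b) T)

{-# OPTIONS --safe #-}
-- π_σ restricts, for every b, to a bijection from the σ-fibre 𝓕^σ_{𝓛,b} onto the fibre
-- 𝓕_{𝓛^σ,π_σ b}: it lands there because it is linear and drops only the unconstrained
-- coordinates, it is onto because every x ≡ π_σ b mod 𝓛^σ is π_σ of some b + l with l ∈ 𝓛,
-- and it is injective because two points of a σ-fibre differ by an element of 𝓛 and
-- ker π_σ ∩ 𝓛 = {0}. For points of a σ-fibre, z − z' ∈ π_σ⁻¹(S) iff π_σ z − π_σ z' ∈ S,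
-- so the two graphs are isomorphic. Finally every b' ∈ ℤ^{σ̄} is π_σ b for some b.
module Submission where

open import Defs
open import Data.Nat using (ℕ)
open import Data.Integer using (ℤ; +_; _-_; -_; _≤_) renaming (_+_ to _+ℤ_)
open import Data.Integer.Properties using (i-j≡0⇒i≡j)
open import Data.Integer.Tactic.RingSolver using (solve-∀)
open import Data.Fin using (Fin; zero; suc)
open import Data.Fin.Subset using (Subset; _∉_)
open import Data.Bool using (true; false)
open import Data.Vec using (Vec; []; _∷_; lookup; zipWith; map; here; there)
open import Data.Vec.Properties using (lookup∘tabulate; ∷-injectiveˡ; ∷-injectiveʳ)
open import Data.Product using (∃; _×_; _,_; proj₁)
open import Data.Sum using () renaming (map to ⊎-map)
open import Data.Empty using (⊥-elim)
open import Function.Bundles using (_⇔_; mk⇔)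
open import Relation.Binary.PropositionalEquality
  using (_≡_; refl; sym; cong; cong₂; subst; module ≡-Reasoning)
open import Relation.Binary.Construct.Closure.ReflexiveTransitive using (Star; ε; _◅_; gmap)

private
  variable
    m n : ℕ

module _ {A B : Set} {R : A → A → Set} {R′ : B → B → Set} (P : A → Set) (f : A → B)
  (lift : ∀ {z y} → P z → R′ (f z) y → ∃ λ z′ → P z′ × f z′ ≡ y × R z z′) where

  Star-lift : ∀ {z y} → P z → Star R′ (f z) y → ∃ λ z′ → P z′ × f z′ ≡ y × Star R z z′
  Star-lift pz ε = _ , pz , refl , ε
  Star-lift pz (r ◅ rs) with lift pz r
  ... | z₁ , pz₁ , refl , r₁ with Star-lift pz₁ rs
  ...   | z′ , pz′ , fz′≡y , rs₁ = z′ , pz′ , fz′≡y , r₁ ◅ rs₁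

⊖-self : (u : Vec ℤ m) → u ⊖ u ≡ 𝟘
⊖-self []      = refl
⊖-self (a ∷ u) = cong₂ _∷_ (cancel a) (⊖-self u)
  where
  cancel : ∀ a → a - a ≡ + 0
  cancel = solve-∀

⊖≡𝟘⇒≡ : (u v : Vec ℤ m) → u ⊖ v ≡ 𝟘 → u ≡ v
⊖≡𝟘⇒≡ []      []      _ = refl
⊖≡𝟘⇒≡ (a ∷ u) (b ∷ v) e =
  cong₂ _∷_ (i-j≡0⇒i≡j a b (∷-injectiveˡ e)) (⊖≡𝟘⇒≡ u v (∷-injectiveʳ e))

⊕-⊖-cancelˡ : (u v : Vec ℤ m) → (u ⊕ v) ⊖ u ≡ v
⊕-⊖-cancelˡ []      []      = refl
⊕-⊖-cancelˡ (a ∷ u) (b ∷ v) = cong₂ _∷_ (cancel a b) (⊕-⊖-cancelˡ u v)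
  where
  cancel : ∀ a b → (a +ℤ b) - a ≡ b
  cancel = solve-∀

⊕-⊖-inverse : (u v : Vec ℤ m) → u ⊕ (v ⊖ u) ≡ v
⊕-⊖-inverse []      []      = refl
⊕-⊖-inverse (a ∷ u) (b ∷ v) = cong₂ _∷_ (inverse a b) (⊕-⊖-inverse u v)
  where
  inverse : ∀ a b → a +ℤ (b - a) ≡ b
  inverse = solve-∀

⊖-⊖-cancelʳ : (u v w : Vec ℤ m) → (u ⊖ w) ⊖ (v ⊖ w) ≡ u ⊖ v
⊖-⊖-cancelʳ []      []      []      = refl
⊖-⊖-cancelʳ (a ∷ u) (b ∷ v) (c ∷ w) = cong₂ _∷_ (cancel a b c) (⊖-⊖-cancelʳ u v w)
  where
  cancel : ∀ a b c → (a - c) - (b - c) ≡ a - b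
  cancel = solve-∀

⊕-neg≡⊖ : (u v : Vec ℤ m) → u ⊕ map -_ v ≡ u ⊖ v
⊕-neg≡⊖ []      []      = refl
⊕-neg≡⊖ (a ∷ u) (b ∷ v) = cong (a - b ∷_) (⊕-neg≡⊖ u v)

⊖-mem : {L : ZSet n} → IsLattice L → ∀ {u v} → L u → L v → L (u ⊖ v)
⊖-mem {L = L} isL {u} {v} Lu Lv =
  subst L (⊕-neg≡⊖ u v) (add-mem u (map -_ v) Lu (neg-mem v Lv))
  where open IsLattice isL

lookup-proj : (σ : Subset n) (z : Vec ℤ n) (i : Fin (nOut σ)) →
              lookup (proj σ z) i ≡ lookup z (idxOut σ i)
lookup-proj σ z = lookup∘tabulate _

proj-zipWith : (f : ℤ → ℤ → ℤ) (σ : Subset n) (u v : Vec ℤ n) →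
               proj σ (zipWith f u v) ≡ zipWith f (proj σ u) (proj σ v)
proj-zipWith f []          []      []      = refl
proj-zipWith f (false ∷ σ) (a ∷ u) (b ∷ v) = cong (f a b ∷_) (proj-zipWith f σ u v)
proj-zipWith f (true ∷ σ)  (a ∷ u) (b ∷ v) = proj-zipWith f σ u v

proj-⊕ : (σ : Subset n) (u v : Vec ℤ n) → proj σ (u ⊕ v) ≡ proj σ u ⊕ proj σ v
proj-⊕ = proj-zipWith _+ℤ_

proj-⊖ : (σ : Subset n) (u v : Vec ℤ n) → proj σ (u ⊖ v) ≡ proj σ u ⊖ proj σ v
proj-⊖ = proj-zipWith _-_

idxOut-∉ : (σ : Subset n) (i : Fin (nOut σ)) → idxOut σ i ∉ σ
idxOut-∉ (false ∷ σ) zero    ()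
idxOut-∉ (false ∷ σ) (suc i) (there p) = idxOut-∉ σ i p
idxOut-∉ (true ∷ σ)  i       (there p) = idxOut-∉ σ i p

∉⇒∃idxOut : (σ : Subset n) (j : Fin n) → j ∉ σ → ∃ λ i → idxOut σ i ≡ j
∉⇒∃idxOut (false ∷ σ) zero    _  = zero , refl
∉⇒∃idxOut (false ∷ σ) (suc j) j∉ with ∉⇒∃idxOut σ j (λ p → j∉ (there p))
... | i , refl = suc i , refl
∉⇒∃idxOut (true ∷ σ)  zero    j∉ = ⊥-elim (j∉ here)
∉⇒∃idxOut (true ∷ σ)  (suc j) j∉ with ∉⇒∃idxOut σ j (λ p → j∉ (there p))
... | i , refl = i , refl

module _ (P : ℤ → Set) (σ : Subset n) (z : Vec ℤ n) where

  All∉⇒All-proj : (∀ j → j ∉ σ → P (lookup z j)) → ∀ i → P (lookup (proj σ z) i)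
  All∉⇒All-proj all∉ i = subst P (sym (lookup-proj σ z i)) (all∉ _ (idxOut-∉ σ i))

  All-proj⇒All∉ : (∀ i → P (lookup (proj σ z) i)) → ∀ j → j ∉ σ → P (lookup z j)
  All-proj⇒All∉ all j j∉ with ∉⇒∃idxOut σ j j∉
  ... | i , refl = subst P (lookup-proj σ z i) (all i)

pad : (σ : Subset n) → Vec ℤ (nOut σ) → Vec ℤ n
pad []          []       = []
pad (false ∷ σ) (a ∷ y)  = a ∷ pad σ y
pad (true ∷ σ)  y        = + 0 ∷ pad σ y

proj-pad : (σ : Subset n) (y : Vec ℤ (nOut σ)) → proj σ (pad σ y) ≡ y
proj-pad []          []      = refl
proj-pad (false ∷ σ) (a ∷ y) = cong (a ∷_) (proj-pad σ y)
proj-pad (true ∷ σ)  y       = proj-pad σ y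

module _ {L : ZSet n} (isL : IsLattice L) (σ : Subset n) where

  open ≡-Reasoning

  TauFiber-⊖ : ∀ {b z z′} → TauFiber σ L b z → TauFiber σ L b z′ → L (z ⊖ z′)
  TauFiber-⊖ {b} {z} {z′} (_ , Lz-b) (_ , Lz′-b) =
    subst L (⊖-⊖-cancelʳ z z′ b) (⊖-mem isL Lz-b Lz′-b)

  proj-TauFiber : ∀ {b z} → TauFiber σ L b z → Fiber (projLattice σ L) (proj σ b) (proj σ z)
  proj-TauFiber {b} {z} (z≥0 , Lz-b) = All∉⇒All-proj (+ 0 ≤_) σ z z≥0 , z ⊖ b , Lz-b , proj-⊖ σ z b

  Fiber-lift : ∀ {b x} → Fiber (projLattice σ L) (proj σ b) x →
               ∃ λ z → TauFiber σ L b z × proj σ z ≡ x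
  Fiber-lift {b} {x} (x≥0 , l , Ll , πl≡x-πb) = b ⊕ l , (z≥0 , Lz-b) , πz≡x
    where
    πz≡x : proj σ (b ⊕ l) ≡ x
    πz≡x = begin
      proj σ (b ⊕ l)             ≡⟨ proj-⊕ σ b l ⟩
      proj σ b ⊕ proj σ l        ≡⟨ cong (proj σ b ⊕_) πl≡x-πb ⟩
      proj σ b ⊕ (x ⊖ proj σ b)  ≡⟨ ⊕-⊖-inverse (proj σ b) x ⟩
      x                          ∎
    z≥0 : ∀ j → j ∉ σ → + 0 ≤ lookup (b ⊕ l) j
    z≥0 = All-proj⇒All∉ (+ 0 ≤_) σ (b ⊕ l) (subst (λ y → ∀ i → + 0 ≤ lookup y i) (sym πz≡x) x≥0)
    Lz-b : L ((b ⊕ l) ⊖ b)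
    Lz-b = subst L (sym (⊕-⊖-cancelˡ b l)) Ll

  proj-injective-TauFiber : KerTrivial σ L → ∀ {b z z′} → TauFiber σ L b z → TauFiber σ L b z′ →
                            proj σ z ≡ proj σ z′ → z ≡ z′
  proj-injective-TauFiber ker {z = z} {z′} tz tz′ πz≡πz′ =
    ⊖≡𝟘⇒≡ z z′ (ker (z ⊖ z′) (TauFiber-⊖ tz tz′) (begin
      proj σ (z ⊖ z′)           ≡⟨ proj-⊖ σ z z′ ⟩
      proj σ z ⊖ proj σ z′      ≡⟨ cong (_⊖ proj σ z′) πz≡πz′ ⟩
      proj σ z′ ⊖ proj σ z′     ≡⟨ ⊖-self (proj σ z′) ⟩
      𝟘                         ∎))

  module _ (S : ZSet (nOut σ)) where

    preimage-⊖ : ∀ {b u v} → TauFiber σ L b u → TauFiber σ L b v →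
                 S (proj σ u ⊖ proj σ v) → preimage σ L S (u ⊖ v)
    preimage-⊖ {u = u} {v} tu tv s = TauFiber-⊖ tu tv , subst S (sym (proj-⊖ σ u v)) s

    proj-Edge : ∀ {b z z′} → Edge (TauFiber σ L b) (preimage σ L S) z z′ →
                Edge (Fiber (projLattice σ L) (proj σ b)) S (proj σ z) (proj σ z′)
    proj-Edge {z = z} {z′} (tz , tz′ , step) =
      proj-TauFiber tz , proj-TauFiber tz′ , ⊎-map (proj-step z z′) (proj-step z′ z) step
      where
      proj-step : ∀ u v → preimage σ L S (u ⊖ v) → S (proj σ u ⊖ proj σ v)
      proj-step u v (_ , s) = subst S (proj-⊖ σ u v) s

    Edge-lift : ∀ {b z x} → TauFiber σ L b z →
                Edge (Fiber (projLattice σ L) (proj σ b)) S (proj σ z) x →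
                ∃ λ z′ → TauFiber σ L b z′ × proj σ z′ ≡ x × Edge (TauFiber σ L b) (preimage σ L S) z z′
    Edge-lift tz (_ , fx , step) with Fiber-lift fx
    ... | z′ , tz′ , refl =
      z′ , tz′ , refl , tz , tz′ , ⊎-map (preimage-⊖ tz tz′) (preimage-⊖ tz′ tz) step

    Fiber-connected⇒TauFiber-connected :
      KerTrivial σ L → ∀ b → Connected (Fiber (projLattice σ L) (proj σ b)) S →
      Connected (TauFiber σ L b) (preimage σ L S)
    Fiber-connected⇒TauFiber-connected ker b conn z z′ tz tz′
      with Star-lift (TauFiber σ L b) (proj σ) Edge-lift tz
             (conn (proj σ z) (proj σ z′) (proj-TauFiber tz) (proj-TauFiber tz′))
    ... | w , tw , πw≡πz′ , path = subst (Star _ z) (proj-injective-TauFiber ker tw tz′ πw≡πz′) path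

    TauFiber-connected⇒Fiber-connected :
      ∀ b → Connected (TauFiber σ L b) (preimage σ L S) →
      Connected (Fiber (projLattice σ L) (proj σ b)) S
    TauFiber-connected⇒Fiber-connected b conn x x′ fx fx′ with Fiber-lift fx | Fiber-lift fx′
    ... | z , tz , refl | z′ , tz′ , refl = gmap (proj σ) proj-Edge (conn z z′ tz tz′)

lemma17 : (n : ℕ) (L : ZSet n) → IsLattice L → (σ : Subset n) → KerTrivial σ L →
          (S : ZSet (nOut σ)) → (∀ y → S y → projLattice σ L y) →
          IsGeneratingSet (projLattice σ L) S ⇔ IsTauGeneratingSet σ L (preimage σ L S)
lemma17 n L isL σ ker S S⊆𝓛σ = mk⇔ to from
  where
  to : IsGeneratingSet (projLattice σ L) S → IsTauGeneratingSet σ L (preimage σ L S)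
  to (_ , conn) = (λ _ → proj₁) , λ b →
    Fiber-connected⇒TauFiber-connected isL σ S ker b (conn (proj σ b))

  from : IsTauGeneratingSet σ L (preimage σ L S) → IsGeneratingSet (projLattice σ L) S
  from (_ , conn) = S⊆𝓛σ , λ b′ →
    subst (λ c → Connected (Fiber (projLattice σ L) c) S) (proj-pad σ b′)
      (TauFiber-connected⇒Fiber-connected isL σ S (pad σ b′) (conn (pad σ b′)))
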